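{- Let $n,h\ge2$ and $p\in\mathcal{P}$. If $\mu(p)\ge\mu_a$, then $\Gamma_{\mu(p)}(p)$ is acyclic. In particular, if $n\in\{2,3\}$, then $\Gamma_{\mu(p)}(p)$ is acyclic.
   Context: $N=\{1,\dots,n\}$, $H=\{1,\dots,h\}$, $\mathcal{P}=\mathcal{L}(N)^h$ the set of profiles of linear orders on $N$; $x>_{p_i}y$ means individual $i$ ranks $x$ above $y$. For integers $\mu$ with $h/2<\mu\le h$: $D_\mu(p)=\{x\in N:\forall y,\ |\{i: y>_{p_i}x\}|<\mu\}$; $\mu(p)=\min\{\mu: D_\mu(p)\ne\varnothing\}$; $\Gamma_\mu(p)$ is the directed graph on $N$ with arcs $(x,y)$ whenever $|\{i:x>_{p_i}y\}|\ge\mu$. The acyclicity threshold is $\mu_a=\min\{m\in\mathbb{N}\cap(h/2,h]: m>\frac{n-2}{n-1}h\}$. A graph is acyclic if no subgraph is an $l$-cycle ($l\ge2$ vertices $x_1,\dots,x_l$ with arcs exactly $(x_j,x_{j+1})$, $x_{l+1}=x_1$). -}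

module Defs where

open import Data.Nat using (ℕ; zero; suc; _+_; _*_; _∸_; _≤_; _<_)
open import Data.Fin using (Fin)
import Data.Fin as F
open import Data.Bool using (true; false)
open import Data.List using (List; []; _∷_; _++_; [_]; length)
open import Data.List.Relation.Unary.Unique.Propositional using (Unique)
open import Data.List.Relation.Unary.Linked using (Linked)
open import Data.Product using (Σ; _×_; ∃; _,_)
open import Relation.Nullary using (¬_; Dec; yes; no)
open import Relation.Unary using (Pred; Decidable)
open import Relation.Binary using (IsStrictTotalOrder; tri<; tri≈; tri>)
open import Relation.Binary.PropositionalEquality using (_≡_)
open import Level using (0ℓ)

-- A linear (strict total) order on N = Fin n.  x ≻ y means "x is ranked above y".
record LinearOrder (n : ℕ) : Set₁ where
  field
    _≻_ : Fin n → Fin n → Set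
    isStrictTotalOrder : IsStrictTotalOrder _≡_ _≻_
  open IsStrictTotalOrder isStrictTotalOrder public

Profile : ℕ → ℕ → Set₁
Profile n h = Fin h → LinearOrder n

Prefers : ∀ {n h} → Profile n h → Fin h → Fin n → Fin n → Set
Prefers p i x y = LinearOrder._≻_ (p i) x y

prefers? : ∀ {n h} (p : Profile n h) (i : Fin h) (x y : Fin n) → Dec (Prefers p i x y)
prefers? p i x y with LinearOrder.compare (p i) x y
... | tri< a _ _ = yes a
... | tri≈ a _ _ = no a
... | tri> a _ _ = no a

count : ∀ {h} {P : Pred (Fin h) 0ℓ} → Decidable P → ℕ
count {zero} d = 0
count {suc h} d with d F.zero
... | yes _ = suc (count {h} (λ i → d (F.suc i)))
... | no _ = count {h} (λ i → d (F.suc i))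

support : ∀ {n h} → Profile n h → Fin n → Fin n → ℕ
support p x y = count (λ i → prefers? p i x y)

Admissible : ℕ → ℕ → Set
Admissible h μ = (h < 2 * μ) × (μ ≤ h)

InD : ∀ {n h} → ℕ → Profile n h → Fin n → Set
InD μ p x = ∀ y → support p y x < μ

-- μ(p) = min { μ admissible : D_μ(p) ≠ ∅ }   (stated as: m is that minimum)
IsMuOf : ∀ {n h} → Profile n h → ℕ → Set
IsMuOf {n} {h} p m =
  (Admissible h m × ∃ (InD m p)) ×
  (∀ μ → Admissible h μ → ∃ (InD μ p) → m ≤ μ)

-- μ_a = min { m admissible : m > ((n-2)/(n-1)) h }, i.e. (n-1) m > (n-2) h  (n ≥ 2)
AboveAcyc : ℕ → ℕ → ℕ → Set
AboveAcyc n h m = (n ∸ 2) * h < (n ∸ 1) * m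

IsMuA : ℕ → ℕ → ℕ → Set
IsMuA n h a =
  (Admissible h a × AboveAcyc n h a) ×
  (∀ m → Admissible h m → AboveAcyc n h m → a ≤ m)

Γ : ∀ {n h} → ℕ → Profile n h → Fin n → Fin n → Set
Γ μ p x y = μ ≤ support p x y

record Cycle {n : ℕ} (E : Fin n → Fin n → Set) : Set where
  field
    x₁  : Fin n
    xs  : List (Fin n)
    l≥2 : 1 ≤ length xs
    distinct : Unique (x₁ ∷ xs)
    arcs : Linked E (x₁ ∷ xs ++ [ x₁ ])

Acyclic : ∀ {n} → (Fin n → Fin n → Set) → Set
Acyclic E = ¬ Cycle E

module Submission where

-- Let x be a dominant alternative for m = μ(p), i.e. x ∈ D_m(p).  No arc of Γ_m(p) enters x, so a
-- cycle of Γ_m(p) avoids x and has some length L ≤ n − 1.  Summing supports along the cycle gives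
-- at least L·m, while each voter, being transitive, agrees with at most L − 1 of its arcs, so the
-- sum is at most (L − 1)·h.  Hence m/h ≤ (L − 1)/L ≤ (n − 2)/(n − 1), contradicting m ≥ μ_a.
-- For n ∈ {2, 3} the bound m > h/2 alone already exceeds (n − 2)/(n − 1)·h.

open import Defs
open import Data.Nat using (ℕ; zero; suc; _+_; _*_; _∸_; _≤_; _<_; z≤n; s≤s; _≤?_)
open import Data.Nat.Properties
open import Algebra.Properties.CommutativeSemigroup +-commutativeSemigroup
  using () renaming (interchange to +-interchange)
open import Data.Fin using (Fin)
import Data.Fin as F
open import Data.Fin.Properties using (pigeonhole)
open import Data.List using (List; []; _∷_; _++_; [_]; length; lookup)
open import Data.List.Properties using (length-++-comm)
open import Data.List.Relation.Unary.All using (All; []; _∷_; tabulate)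
open import Data.List.Relation.Unary.AllPairs using (_∷_)
open import Data.List.Relation.Unary.Any using (here; there)
open import Data.List.Relation.Unary.Unique.Propositional using (Unique)
open import Data.List.Relation.Unary.Linked using (Linked; _∷_)
open import Data.List.Membership.Propositional using (_∈_)
open import Data.List.Membership.Propositional.Properties using (∈-++⁺ˡ; ∈-++⁺ʳ)
open import Data.Product using (_×_; _,_; ∃)
open import Data.Sum using (_⊎_; inj₁; inj₂)
open import Level using (0ℓ)
open import Relation.Nullary using (¬_; Dec; yes; no; contradiction)
open import Relation.Unary using (Pred)
import Relation.Unary as U
open import Relation.Binary using (Rel; IsStrictPartialOrder; Decidable)
open import Relation.Binary.PropositionalEquality using (_≡_; _≢_; refl; sym; trans; cong; cong₂; subst)

indicator : {P : Set} → Dec P → ℕ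
indicator (yes _) = 1
indicator (no _)  = 0

indicator-≤-1 : {P : Set} (d : Dec P) → indicator d ≤ 1
indicator-≤-1 (yes _) = s≤s z≤n
indicator-≤-1 (no _)  = z≤n

count-suc : ∀ {h} {P : Pred (Fin (suc h)) 0ℓ} (d : U.Decidable P) →
            count d ≡ indicator (d F.zero) + count (λ i → d (F.suc i))
count-suc d with d F.zero
... | yes _ = refl
... | no _  = refl

module _ {A : Set} where

  walkSum : (A → A → ℕ) → A → List A → ℕ
  walkSum f u []      = 0
  walkSum f u (y ∷ r) = f u y + walkSum f y r

  walkSum-cong : ∀ {f g : A → A → ℕ} → (∀ a b → f a b ≡ g a b) →
                 ∀ u r → walkSum f u r ≡ walkSum g u r
  walkSum-cong f≗g u []      = refl
  walkSum-cong f≗g u (y ∷ r) = cong₂ _+_ (f≗g u y) (walkSum-cong f≗g y r)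

  walkSum-zero : ∀ u r → walkSum (λ _ _ → 0) u r ≡ 0
  walkSum-zero u []      = refl
  walkSum-zero u (y ∷ r) = walkSum-zero y r

  walkSum-+ : ∀ (f g : A → A → ℕ) u r →
              walkSum (λ a b → f a b + g a b) u r ≡ walkSum f u r + walkSum g u r
  walkSum-+ f g u []      = refl
  walkSum-+ f g u (y ∷ r) =
    trans (cong ((f u y + g u y) +_) (walkSum-+ f g y r)) (+-interchange (f u y) (g u y) _ _)

  walkSum-≥ : ∀ {m} (f : A → A → ℕ) u r → Linked (λ a b → m ≤ f a b) (u ∷ r) →
              length r * m ≤ walkSum f u r
  walkSum-≥ f u []      _            = z≤n
  walkSum-≥ f u (y ∷ r) (m≤fuy ∷ ℓ) = +-mono-≤ m≤fuy (walkSum-≥ f y r ℓ)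

  Linked-predecessor : ∀ {E : Rel A 0ℓ} {u v r} → Linked E (u ∷ r) → v ∈ r → ∃ λ w → E w v
  Linked-predecessor {u = u} (e ∷ _) (here refl) = u , e
  Linked-predecessor (_ ∷ ℓ) (there v∈r)         = Linked-predecessor ℓ v∈r

module Ascents {A : Set} {_≻_ : Rel A 0ℓ}
               (isSPO : IsStrictPartialOrder _≡_ _≻_) (_≻?_ : Decidable _≻_) where

  open IsStrictPartialOrder isSPO using (irrefl) renaming (trans to ≻-trans)

  ascents : A → List A → ℕ
  ascents = walkSum (λ a b → indicator (a ≻? b))

  ascents-≤-length : ∀ u r → ascents u r ≤ length r
  ascents-≤-length u []      = z≤n
  ascents-≤-length u (y ∷ r) = +-mono-≤ (indicator-≤-1 (u ≻? y)) (ascents-≤-length y r)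

  -- If every step of u → ys → v ascends, transitivity gives u ≻ v.
  ascents-++-∷ʳ : ∀ u ys v → ascents u (ys ++ [ v ]) ≤ length ys ⊎ u ≻ v
  ascents-++-∷ʳ u [] v with u ≻? v
  ... | yes u≻v = inj₂ u≻v
  ... | no _    = inj₁ z≤n
  ascents-++-∷ʳ u (y ∷ ys) v with ascents-++-∷ʳ y ys v | u ≻? y
  ... | inj₁ few | u≻?y    = inj₁ (+-mono-≤ (indicator-≤-1 u≻?y) few)
  ... | inj₂ y≻v | yes u≻y = inj₂ (≻-trans u≻y y≻v)
  ... | inj₂ _   | no _    =
    inj₁ (≤-trans (ascents-≤-length y (ys ++ [ v ])) (≤-reflexive (length-++-comm ys [ v ])))

  closedWalk-ascents : ∀ u ys → ascents u (ys ++ [ u ]) ≤ length ys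
  closedWalk-ascents u ys with ascents-++-∷ʳ u ys u
  ... | inj₁ few = few
  ... | inj₂ u≻u = contradiction u≻u (irrefl refl)

closedWalk-count-≤ : ∀ {A : Set} h (R : Fin h → Rel A 0ℓ) (R? : ∀ i → Decidable (R i)) →
                     (∀ i → IsStrictPartialOrder _≡_ (R i)) → ∀ u ys →
                     walkSum (λ a b → count (λ i → R? i a b)) u (ys ++ [ u ]) ≤ h * length ys
closedWalk-count-≤ zero R R? isSPO u ys = ≤-reflexive (walkSum-zero u (ys ++ [ u ]))
closedWalk-count-≤ (suc h) R R? isSPO u ys = begin
  walkSum (λ a b → count (λ i → R? i a b)) u r
    ≡⟨ walkSum-cong (λ a b → count-suc (λ i → R? i a b)) u r ⟩
  walkSum (λ a b → indicator (R? F.zero a b) + count (λ i → R? (F.suc i) a b)) u r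
    ≡⟨ walkSum-+ _ _ u r ⟩
  ascents u r + walkSum (λ a b → count (λ i → R? (F.suc i) a b)) u r
    ≤⟨ +-mono-≤ (closedWalk-ascents u ys)
                (closedWalk-count-≤ h (λ i → R (F.suc i)) (λ i → R? (F.suc i)) (λ i → isSPO (F.suc i)) u ys) ⟩
  length ys + h * length ys ∎
  where
  open ≤-Reasoning
  open Ascents (isSPO F.zero) (R? F.zero)
  r = ys ++ [ u ]

unique-length-≤ : ∀ {n} (ys : List (Fin n)) → Unique ys → length ys ≤ n
unique-length-≤ {n} ys unique with length ys ≤? n
... | yes ≤n = ≤n
... | no ≰n with pigeonhole (≰⇒> ≰n) (lookup ys)
...   | i , j , i<j , eq = contradiction eq (lookup-distinct unique i j i<j)
  where
  lookup-All : ∀ {A : Set} {P : A → Set} {zs} → All P zs → (k : Fin (length zs)) → P (lookup zs k)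
  lookup-All (pz ∷ _)  F.zero    = pz
  lookup-All (_ ∷ pzs) (F.suc k) = lookup-All pzs k
  lookup-distinct : ∀ {A : Set} {zs : List A} → Unique zs →
                    ∀ k l → k F.< l → lookup zs k ≢ lookup zs l
  lookup-distinct (z∉ ∷ _) F.zero    (F.suc l) _         = lookup-All z∉ l
  lookup-distinct (_ ∷ u)  (F.suc k) (F.suc l) (s≤s k<l) = lookup-distinct u k l k<l

module _ {n} {E : Rel (Fin n) 0ℓ} (C : Cycle E) where
  open Cycle C

  source-∉-cycle : ∀ {x} → (∀ w → ¬ E w x) → All (x ≢_) (x₁ ∷ xs)
  source-∉-cycle no-arc = tabulate λ v∈cycle x≡v →
    let w , w→v = Linked-predecessor arcs (rotate v∈cycle) in no-arc w (subst (E w) (sym x≡v) w→v)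
    where
    rotate : ∀ {v} → v ∈ x₁ ∷ xs → v ∈ xs ++ [ x₁ ]
    rotate (here refl) = ∈-++⁺ʳ xs (here refl)
    rotate (there v∈xs) = ∈-++⁺ˡ v∈xs

  source⇒cycle-length-≤ : ∀ {x} → (∀ w → ¬ E w x) → 2 + length xs ≤ n
  source⇒cycle-length-≤ no-arc = unique-length-≤ (_ ∷ x₁ ∷ xs) (source-∉-cycle no-arc ∷ distinct)

dominant-source : ∀ {n h m} (p : Profile n h) {x} → InD m p x → ∀ w → ¬ Γ m p w x
dominant-source p inD w = <⇒≱ (inD w)

cycle-support-bound : ∀ {n h m} (p : Profile n h) (C : Cycle (Γ m p)) →
                      let k = length (Cycle.xs C) in suc k * m ≤ k * h
cycle-support-bound {h = h} {m} p C = begin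
  suc (length xs) * m                    ≡⟨ cong (_* m) (sym (length-++-comm xs [ x₁ ])) ⟩
  length (xs ++ [ x₁ ]) * m              ≤⟨ walkSum-≥ (support p) x₁ (xs ++ [ x₁ ]) arcs ⟩
  walkSum (support p) x₁ (xs ++ [ x₁ ])  ≤⟨ closedWalk-count-≤ h (Prefers p) (prefers? p) voter-SPO x₁ xs ⟩
  h * length xs                          ≡⟨ *-comm h (length xs) ⟩
  length xs * h                          ∎
  where
  open ≤-Reasoning
  open Cycle C
  voter-SPO : ∀ i → IsStrictPartialOrder _≡_ (Prefers p i)
  voter-SPO i = LinearOrder.isStrictPartialOrder (p i)

-- m/h ≤ k/(k+1) ≤ (n−2)/(n−1), cleared of denominators.
ratio-bound-mono : ∀ {k n m h} → 2 + k ≤ n → m ≤ h → suc k * m ≤ k * h → (n ∸ 1) * m ≤ (n ∸ 2) * h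
ratio-bound-mono {k} {n} {m} {h} 2+k≤n m≤h bound with m≤n⇒∃[o]m+o≡n 2+k≤n
... | d , refl = begin
  (suc k + d) * m    ≡⟨ *-distribʳ-+ m (suc k) d ⟩
  suc k * m + d * m  ≤⟨ +-mono-≤ bound (*-monoʳ-≤ d m≤h) ⟩
  k * h + d * h      ≡⟨ sym (*-distribʳ-+ h k d) ⟩
  (k + d) * h        ∎
  where open ≤-Reasoning

dominant⇒acyclic : ∀ {n h m} (p : Profile n h) {x} → InD m p x → m ≤ h →
                   AboveAcyc n h m → Acyclic (Γ m p)
dominant⇒acyclic p inD m≤h above C =
  <⇒≱ above (ratio-bound-mono (source⇒cycle-length-≤ C (dominant-source p inD)) m≤h (cycle-support-bound p C))

majority⇒positive : ∀ {h m} → h < 2 * m → 0 < m + 0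
majority⇒positive {m = suc _} _ = s≤s z≤n

corollary22 : (n h : ℕ) → 2 ≤ n → 2 ≤ h → (p : Profile n h) → (m : ℕ) → IsMuOf p m →
    ((a : ℕ) → IsMuA n h a → a ≤ m → Acyclic (Γ m p)) × (n ≡ 2 ⊎ n ≡ 3 → Acyclic (Γ m p))
corollary22 n h _ _ p m (((h<2m , m≤h) , (x , inD)) , _) = above-μa , small-n
  where
  acyclic : AboveAcyc n h m → Acyclic (Γ m p)
  acyclic = dominant⇒acyclic p inD m≤h

  above-μa : (a : ℕ) → IsMuA n h a → a ≤ m → Acyclic (Γ m p)
  above-μa a ((_ , a-above) , _) a≤m = acyclic (<-≤-trans a-above (*-monoʳ-≤ (n ∸ 1) a≤m))

  small-n : n ≡ 2 ⊎ n ≡ 3 → Acyclic (Γ m p)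
  small-n (inj₁ refl) = acyclic (majority⇒positive h<2m)
  small-n (inj₂ refl) = acyclic (subst (_< 2 * m) (sym (+-identityʳ h)) h<2m)
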